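{- Let $n\ge 2$, let $\Gamma=\mathbb Z_n$ and let $G$ be the power graph of $\Gamma$. For each divisor $d$ of $n$ with $d<n$ let $V_d=\{x\in\mathbb Z_n:\gcd(x,n)=d\}$ if $d>1$ and $V_1=\{x\in\mathbb Z_n:\gcd(x,n)=1\}\cup\{0\}$, and let $G_d=G[V_d]$. Let $H$ be the graph whose vertices are the divisors $d<n$ of $n$, with $d_i,d_j$ adjacent iff $d_i\mid d_j$ or $d_j\mid d_i$. Then $G=H[G_d: d\mid n,\ d<n]$, where each $G_d$ is a complete graph, $|V_1|=\varphi(n)+1$ and $|V_d|=\varphi(n/d)$ for $d>1$.
   Context: The power graph of a finite group has the group as vertex set, distinct $a,b$ adjacent iff one is a power of the other. $\varphi$ is Euler's totient function. For a graph $H$ with vertices indexed by a set $D$ and graphs $G_d$ ($d\in D$) with disjoint vertex sets, the generalized composition $H[G_d:d\in D]$ has vertex set $\bigsqcup_d V(G_d)$, two vertices of the same $G_d$ adjacent iff adjacent in $G_d$, and vertices of $G_d$, $G_{d'}$ ($d\neq d'$) adjacent iff $d,d'$ are adjacent in $H$. -}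

module Defs where

open import Level using (0ℓ)
open import Data.Nat using (ℕ; zero; suc; _*_; _<_; _≟_; NonZero)
open import Data.Nat.Divisibility using (_∣_)
open import Data.Nat.DivMod using (_mod_)
open import Data.Nat.GCD using (gcd)
open import Data.Fin using (Fin; toℕ)
open import Data.List using (List; length; filter; map; upTo; allFin)
open import Data.Product using (Σ; ∃-syntax; _×_; _,_; proj₁; proj₂)
open import Data.Sum using (_⊎_)
open import Relation.Nullary using (¬_; Dec)
open import Relation.Nullary.Decidable using (_⊎-dec_; _×-dec_)
open import Relation.Binary.PropositionalEquality using (_≡_; _≢_; subst)

record Graph : Set₁ where
  field
    Vertex : Set
    Adj    : Vertex → Vertex → Set
open Graph public

induced : (G : Graph) → (Vertex G → Set) → Graph
induced G P = record
  { Vertex = Σ (Vertex G) P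
  ; Adj    = λ u v → Adj G (proj₁ u) (proj₁ v)
  }

IsComplete : Graph → Set
IsComplete G = ∀ u v → u ≢ v → Adj G u v

gcomp : (H : Graph) → (Vertex H → Graph) → Graph
gcomp H G = record
  { Vertex = Σ (Vertex H) (λ d → Vertex (G d))
  ; Adj    = λ u v →
      (Σ (proj₁ u ≡ proj₁ v) λ p →
          Adj (G (proj₁ v)) (subst (λ d → Vertex (G d)) p (proj₂ u)) (proj₂ v))
      ⊎ (proj₁ u ≢ proj₁ v × Adj H (proj₁ u) (proj₁ v))
  }

module _ (n : ℕ) .{{_ : NonZero n}} where

  -- k-th power of a in the additive group Z_n, i.e. k·a
  pow : Fin n → ℕ → Fin n
  pow a k = (k * toℕ a) mod n

  IsPowerOf : Fin n → Fin n → Set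
  IsPowerOf b a = ∃[ k ] b ≡ pow a k

  PowerGraph : Graph
  PowerGraph = record
    { Vertex = Fin n
    ; Adj    = λ a b → a ≢ b × (IsPowerOf a b ⊎ IsPowerOf b a)
    }

  InV : ℕ → Fin n → Set
  InV d x = gcd (toℕ x) n ≡ d ⊎ (d ≡ 1 × toℕ x ≡ 0)

  InV? : ∀ d x → Dec (InV d x)
  InV? d x = (gcd (toℕ x) n ≟ d) ⊎-dec ((d ≟ 1) ×-dec (toℕ x ≟ 0))

  cardV : ℕ → ℕ
  cardV d = length (filter (InV? d) (allFin n))

  record Divisor : Set where
    constructor div
    field
      val    : ℕ
      .isDiv : val ∣ n
      .lt    : val < n
  open Divisor public

  DivGraph : Graph
  DivGraph = record
    { Vertex = Divisor
    ; Adj    = λ d e → d ≢ e × (val d ∣ val e ⊎ val e ∣ val d)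
    }

  Gd : Divisor → Graph
  Gd d = induced PowerGraph (InV (val d))

  embed : Vertex (gcomp DivGraph Gd) → Fin n
  embed u = proj₁ (proj₂ u)

φ : ℕ → ℕ
φ m = length (filter (λ k → gcd k m ≟ 1) (map suc (upTo m)))

{-# OPTIONS --safe #-}
module Submission where

-- Write g(x) = gcd(x, n).  By Bézout, g(a) is a multiple of a modulo n, so
-- b is a power (multiple) of a in ℤₙ exactly when g(a) ∣ b.  Hence for
-- nonzero x ∈ V_d, y ∈ V_e the elements are adjacent iff d ∣ e or e ∣ d,
-- while 0 ∈ V₁ is a multiple of everything.  For d > 1 and n = q d, the
-- elements of V_d are the i d with i < q and gcd(i, q) = 1, since
-- gcd(i d, q d) = d gcd(i, q); counting them gives φ(q).

open import Level using (Level)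
open import Defs
open import Data.Bool using (Bool; true; false)
open import Data.Nat
open import Data.Nat.Properties
open import Data.Nat.Divisibility
open import Data.Nat.DivMod
open import Data.Nat.GCD
open import Data.Nat.Tactic.RingSolver using (solve-∀)
open import Data.List using (List; _∷_; length; filter; applyUpTo; tabulate)
open import Data.List.Properties using (map-upTo)
open import Data.Fin using (Fin; toℕ)
import Data.Fin as Fin
open import Data.Fin.Properties using (toℕ-injective; toℕ-fromℕ<; toℕ<n)
open import Data.Product using (Σ; ∃-syntax; _×_; _,_; proj₁; proj₂)
open import Data.Sum using (_⊎_; inj₁; inj₂)
open import Data.Empty using (⊥-elim)
open import Function using (_∘_)
open import Function.Definitions using (Bijective)
open import Function.Bundles using (_⇔_; mk⇔; Equivalence)
open import Relation.Nullary using (Dec; yes; no; does)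
open import Relation.Nullary.Decidable using (dec-true; dec-false; does-⇔; recompute; _⊎-dec_; _×-dec_)
open import Relation.Unary using (Pred; Decidable)
open import Relation.Binary.PropositionalEquality
open Bézout using (identity; +-; -+)

private
  variable
    ℓ ℓ′ : Level
    A : Set ℓ

boolToℕ : Bool → ℕ
boolToℕ true  = 1
boolToℕ false = 0

countBelow : (ℕ → Bool) → ℕ → ℕ
countBelow f zero    = 0
countBelow f (suc m) = boolToℕ (f 0) + countBelow (f ∘ suc) m

countBelow-cong : ∀ {f g} → (∀ k → f k ≡ g k) → ∀ m → countBelow f m ≡ countBelow g m
countBelow-cong f≗g zero    = refl
countBelow-cong f≗g (suc m) = cong₂ _+_ (cong boolToℕ (f≗g 0)) (countBelow-cong (f≗g ∘ suc) m)

countBelow-false : ∀ {f} m → (∀ k → k < m → f k ≡ false) → countBelow f m ≡ 0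
countBelow-false zero    f≡false = refl
countBelow-false (suc m) f≡false
  rewrite f≡false 0 z<s = countBelow-false m (λ k k<m → f≡false (suc k) (s<s k<m))

countBelow-+ : ∀ f m n → countBelow f (m + n) ≡ countBelow f m + countBelow (λ k → f (m + k)) n
countBelow-+ f zero    n = refl
countBelow-+ f (suc m) n = trans (cong (boolToℕ (f 0) +_) (countBelow-+ (f ∘ suc) m n))
                                 (sym (+-assoc (boolToℕ (f 0)) _ _))

countBelow-suc : ∀ f m → countBelow f (suc m) ≡ countBelow f m + boolToℕ (f m)
countBelow-suc f zero    = +-comm (boolToℕ (f 0)) 0
countBelow-suc f (suc m) = trans (cong (boolToℕ (f 0) +_) (countBelow-suc (f ∘ suc) m))
                                 (sym (+-assoc (boolToℕ (f 0)) _ _))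

countBelow-shift : ∀ f m → f 0 ≡ f m → countBelow (f ∘ suc) m ≡ countBelow f m
countBelow-shift f zero    _      = refl
countBelow-shift f (suc m) f0≡fm = begin
  countBelow (f ∘ suc) (suc m)                 ≡⟨ countBelow-suc (f ∘ suc) m ⟩
  countBelow (f ∘ suc) m + boolToℕ (f (suc m)) ≡⟨ cong (λ b → countBelow (f ∘ suc) m + boolToℕ b) f0≡fm ⟨
  countBelow (f ∘ suc) m + boolToℕ (f 0)       ≡⟨ +-comm _ (boolToℕ (f 0)) ⟩
  countBelow f (suc m)                         ∎
  where open ≡-Reasoning

countBelow-differAt0 : ∀ {f g} m .{{_ : NonZero m}} → f 0 ≡ true → g 0 ≡ false →
  (∀ k → f (suc k) ≡ g (suc k)) → countBelow f m ≡ countBelow g m + 1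
countBelow-differAt0 (suc m) f0 g0 f≗g rewrite f0 | g0 =
  trans (cong suc (countBelow-cong f≗g m)) (+-comm 1 _)

countBelow-multiples : ∀ d q .{{_ : NonZero d}} (f : ℕ → Bool) → (∀ k → d ∤ k → f k ≡ false) →
  countBelow f (q * d) ≡ countBelow (λ i → f (i * d)) q
countBelow-multiples d         zero    f f≡false = refl
countBelow-multiples d@(suc d′) (suc q) f f≡false = begin
  countBelow f (d + q * d)                              ≡⟨ countBelow-+ f d (q * d) ⟩
  countBelow f d + countBelow (λ k → f (d + k)) (q * d) ≡⟨ cong₂ _+_ countBelow-d
                                                             (countBelow-multiples d q _ f[d+_]≡false) ⟩
  boolToℕ (f 0) + countBelow (λ i → f (d + i * d)) q    ∎
  where
  open ≡-Reasoning
  countBelow-d : countBelow f d ≡ boolToℕ (f 0)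
  countBelow-d = trans (cong (boolToℕ (f 0) +_)
                             (countBelow-false d′ (λ k k<d′ → f≡false (suc k) (>⇒∤ (s<s k<d′)))))
                       (+-identityʳ _)
  f[d+_]≡false : ∀ k → d ∤ k → f (d + k) ≡ false
  f[d+_]≡false k d∤k = f≡false (d + k) (λ d∣d+k → d∤k (∣m+n∣m⇒∣n d∣d+k ∣-refl))

length-filter-∷ : {P : Pred A ℓ′} (P? : Decidable P) (x : A) (xs : List A) →
  length (filter P? (x ∷ xs)) ≡ boolToℕ (does (P? x)) + length (filter P? xs)
length-filter-∷ P? x xs with does (P? x)
... | true  = refl
... | false = refl

length-filter-applyUpTo : {P : Pred A ℓ′} (P? : Decidable P) (f : ℕ → A) (m : ℕ) →
  length (filter P? (applyUpTo f m)) ≡ countBelow (λ k → does (P? (f k))) m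
length-filter-applyUpTo P? f zero    = refl
length-filter-applyUpTo P? f (suc m) =
  trans (length-filter-∷ P? (f 0) _) (cong (_ +_) (length-filter-applyUpTo P? (f ∘ suc) m))

length-filter-tabulate : {P : Pred A ℓ′} (P? : Decidable P) {m : ℕ} (f : Fin m → A) (g : ℕ → Bool) →
  (∀ i → does (P? (f i)) ≡ g (toℕ i)) → length (filter P? (tabulate f)) ≡ countBelow g m
length-filter-tabulate P? {zero}  f g P?∘f≗g = refl
length-filter-tabulate P? {suc m} f g P?∘f≗g =
  trans (length-filter-∷ P? (f Fin.zero) _)
        (cong₂ _+_ (cong boolToℕ (P?∘f≗g Fin.zero))
                   (length-filter-tabulate P? (f ∘ Fin.suc) (g ∘ suc) (P?∘f≗g ∘ Fin.suc)))

gcd[n,n]≡n : ∀ n → gcd n n ≡ n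
gcd[n,n]≡n n = GCD.unique (gcd-GCD n n) GCD.refl

coprimeTo : ℕ → ℕ → Bool
coprimeTo m k = does (gcd k m ≟ 1)

φ≡countBelow-coprimeTo : ∀ m → φ m ≡ countBelow (coprimeTo m) m
φ≡countBelow-coprimeTo m = begin
  φ m                                                   ≡⟨ cong (length ∘ filter _) (map-upTo suc m) ⟩
  length (filter (λ k → gcd k m ≟ 1) (applyUpTo suc m)) ≡⟨ length-filter-applyUpTo (λ k → gcd k m ≟ 1) suc m ⟩
  countBelow (coprimeTo m ∘ suc) m                      ≡⟨ countBelow-shift (coprimeTo m) m coprime[0]≡coprime[m] ⟩
  countBelow (coprimeTo m) m                            ∎
  where
  open ≡-Reasoning
  coprime[0]≡coprime[m] : coprimeTo m 0 ≡ coprimeTo m m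
  coprime[0]≡coprime[m] = cong (λ g → does (g ≟ 1)) (trans (gcd-identityˡ m) (sym (gcd[n,n]≡n m)))

toℕ-mod : ∀ m n .{{_ : NonZero n}} → toℕ (m mod n) ≡ m % n
toℕ-mod m n = toℕ-fromℕ< (m%n<n m n)

gcd≡multiple-mod : ∀ a n .{{_ : NonZero n}} → ∃[ k ] (k * a) % n ≡ gcd a n % n
gcd≡multiple-mod a n@(suc m) with identity (gcd-GCD a n)
... | +- x y g+yn≡xa = x , (begin
  (x * a) % n           ≡⟨ %-congˡ g+yn≡xa ⟨
  (gcd a n + y * n) % n ≡⟨ [m+kn]%n≡m%n (gcd a n) y n ⟩
  gcd a n % n           ∎)
  where open ≡-Reasoning
... | -+ x y g+xa≡yn = m * x , (begin
  (m * x * a) % n         ≡⟨ [m+kn]%n≡m%n (m * x * a) g n ⟨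
  (m * x * a + g * n) % n ≡⟨ %-congˡ (trans (reassociate m x a g) (cong (λ t → g + m * t) g+xa≡yn)) ⟩
  (g + m * (y * n)) % n   ≡⟨ %-congˡ (cong (g +_) (*-assoc m y n)) ⟨
  (g + m * y * n) % n     ≡⟨ [m+kn]%n≡m%n g (m * y) n ⟩
  g % n                   ∎)
  where
  open ≡-Reasoning
  g = gcd a n
  -- x a ≡ -g modulo n, so multiplying by m ≡ -1 gives g
  reassociate : ∀ m x a g → m * x * a + g * suc m ≡ g + m * (g + x * a)
  reassociate = solve-∀

isPowerOf⇔gcd∣ : ∀ n .{{_ : NonZero n}} (a b : Fin n) → IsPowerOf n b a ⇔ gcd (toℕ a) n ∣ toℕ b
isPowerOf⇔gcd∣ n a b = mk⇔ to from
  where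
  g = gcd (toℕ a) n
  to : IsPowerOf n b a → g ∣ toℕ b
  to (k , refl) = subst (g ∣_) (sym (toℕ-mod (k * toℕ a) n))
    (%-presˡ-∣ (∣-trans (gcd[m,n]∣m (toℕ a) n) (n∣m*n k)) (gcd[m,n]∣n (toℕ a) n))
  from : g ∣ toℕ b → IsPowerOf n b a
  from (divides c b≡cg) with k , ka≡g ← gcd≡multiple-mod (toℕ a) n =
    c * k , toℕ-injective (sym (begin
    toℕ ((c * k * toℕ a) mod n)       ≡⟨ toℕ-mod (c * k * toℕ a) n ⟩
    (c * k * toℕ a) % n               ≡⟨ %-congˡ (*-assoc c k (toℕ a)) ⟩
    (c * (k * toℕ a)) % n             ≡⟨ %-distribˡ-* c (k * toℕ a) n ⟩
    ((c % n) * ((k * toℕ a) % n)) % n ≡⟨ cong (λ t → ((c % n) * t) % n) ka≡g ⟩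
    ((c % n) * (g % n)) % n           ≡⟨ %-distribˡ-* c g n ⟨
    (c * g) % n                       ≡⟨ %-congˡ b≡cg ⟨
    toℕ b % n                         ≡⟨ m<n⇒m%n≡m (toℕ<n b) ⟩
    toℕ b                             ∎))
    where open ≡-Reasoning

isPowerOf⇒gcd∣gcd : ∀ n .{{_ : NonZero n}} (a b : Fin n) →
  IsPowerOf n b a → gcd (toℕ a) n ∣ gcd (toℕ b) n
isPowerOf⇒gcd∣gcd n a b b∈⟨a⟩ =
  gcd-greatest (Equivalence.to (isPowerOf⇔gcd∣ n a b) b∈⟨a⟩) (gcd[m,n]∣n (toℕ a) n)

zero-isPowerOf : ∀ n .{{_ : NonZero n}} (a b : Fin n) → toℕ b ≡ 0 → IsPowerOf n b a
zero-isPowerOf n a b b≡0 = Equivalence.from (isPowerOf⇔gcd∣ n a b) (subst (_ ∣_) (sym b≡0) (_ ∣0))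

module _ (n : ℕ) .{{_ : NonZero n}} where

  toℕ≡0⇒gcd≡n : ∀ {x : Fin n} → toℕ x ≡ 0 → gcd (toℕ x) n ≡ n
  toℕ≡0⇒gcd≡n x≡0 = trans (cong (λ t → gcd t n) x≡0) (gcd-identityˡ n)

  InV-unique : ∀ {d e x} → d < n → e < n → InV n d x → InV n e x → d ≡ e
  InV-unique d<n e<n (inj₁ gcd≡d)      (inj₁ gcd≡e)      = trans (sym gcd≡d) gcd≡e
  InV-unique d<n e<n (inj₁ gcd≡d)      (inj₂ (_ , x≡0))  =
    ⊥-elim (<-irrefl (trans (sym gcd≡d) (toℕ≡0⇒gcd≡n x≡0)) d<n)
  InV-unique d<n e<n (inj₂ (_ , x≡0))  (inj₁ gcd≡e)      =
    ⊥-elim (<-irrefl (trans (sym gcd≡e) (toℕ≡0⇒gcd≡n x≡0)) e<n)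
  InV-unique d<n e<n (inj₂ (d≡1 , _)) (inj₂ (e≡1 , _)) = trans d≡1 (sym e≡1)

  InV-comparable⇔ : ∀ {d e x y} → InV n d x → InV n e y →
    (IsPowerOf n x y ⊎ IsPowerOf n y x) ⇔ (d ∣ e ⊎ e ∣ d)
  InV-comparable⇔ {d} {e} {x} {y} x∈V y∈V = mk⇔ (to x∈V y∈V) (from x∈V y∈V)
    where
    to : InV n d x → InV n e y → IsPowerOf n x y ⊎ IsPowerOf n y x → d ∣ e ⊎ e ∣ d
    to (inj₂ (refl , _)) _ _ = inj₁ (1∣ e)
    to (inj₁ _) (inj₂ (refl , _)) _ = inj₂ (1∣ d)
    to (inj₁ refl) (inj₁ refl) (inj₁ x∈⟨y⟩) = inj₂ (isPowerOf⇒gcd∣gcd n y x x∈⟨y⟩)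
    to (inj₁ refl) (inj₁ refl) (inj₂ y∈⟨x⟩) = inj₁ (isPowerOf⇒gcd∣gcd n x y y∈⟨x⟩)
    from : InV n d x → InV n e y → d ∣ e ⊎ e ∣ d → IsPowerOf n x y ⊎ IsPowerOf n y x
    from (inj₂ (_ , x≡0)) _ _ = inj₁ (zero-isPowerOf n y x x≡0)
    from (inj₁ _) (inj₂ (_ , y≡0)) _ = inj₂ (zero-isPowerOf n x y y≡0)
    from (inj₁ refl) (inj₁ refl) (inj₁ d∣e) =
      inj₂ (Equivalence.from (isPowerOf⇔gcd∣ n x y) (∣-trans d∣e (gcd[m,n]∣m (toℕ y) n)))
    from (inj₁ refl) (inj₁ refl) (inj₂ e∣d) =
      inj₁ (Equivalence.from (isPowerOf⇔gcd∣ n y x) (∣-trans e∣d (gcd[m,n]∣m (toℕ x) n)))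

  val-injective : ∀ {d e : Divisor n} → val d ≡ val e → d ≡ e
  val-injective {div _ _ _} {div _ _ _} refl = refl

  val<n : (d : Divisor n) → val d < n
  val<n (div v _ v<n) = recompute (v <? n) v<n

  InVℕ? : ∀ d k → Dec (gcd k n ≡ d ⊎ (d ≡ 1 × k ≡ 0))
  InVℕ? d k = (gcd k n ≟ d) ⊎-dec ((d ≟ 1) ×-dec (k ≟ 0))

  isInV : ℕ → ℕ → Bool
  isInV d k = does (InVℕ? d k)

  cardV≡countBelow : ∀ d → cardV n d ≡ countBelow (isInV d) n
  cardV≡countBelow d = length-filter-tabulate (InV? n d) (λ x → x) (isInV d) (λ _ → refl)

  cardV≡φ : ∀ d → 1 < d → ∀ q → q * d ≡ n → cardV n d ≡ φ q
  cardV≡φ d@(suc _) 1<d q qd≡n = begin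
    cardV n d                            ≡⟨ cardV≡countBelow d ⟩
    countBelow (isInV d) n               ≡⟨ cong (countBelow (isInV d)) qd≡n ⟨
    countBelow (isInV d) (q * d)         ≡⟨ countBelow-multiples d q (isInV d) isInV-nonMultiple ⟩
    countBelow (λ i → isInV d (i * d)) q ≡⟨ countBelow-cong isInV-multiple q ⟩
    countBelow (coprimeTo q) q           ≡⟨ φ≡countBelow-coprimeTo q ⟨
    φ q                                  ∎
    where
    open ≡-Reasoning
    d≢1 : d ≢ 1
    d≢1 d≡1 = <-irrefl (sym d≡1) 1<d
    isInV-nonMultiple : ∀ k → d ∤ k → isInV d k ≡ false
    isInV-nonMultiple k d∤k = dec-false (InVℕ? d k) λ
      { (inj₁ gcd≡d)      → d∤k (subst (_∣ k) gcd≡d (gcd[m,n]∣m k n))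
      ; (inj₂ (d≡1 , _)) → d≢1 d≡1 }
    gcd[id,n]≡d*gcd[i,q] : ∀ i → gcd (i * d) n ≡ d * gcd i q
    gcd[id,n]≡d*gcd[i,q] i = begin
      gcd (i * d) n       ≡⟨ cong (gcd (i * d)) qd≡n ⟨
      gcd (i * d) (q * d) ≡⟨ cong₂ gcd (*-comm i d) (*-comm q d) ⟩
      gcd (d * i) (d * q) ≡⟨ c*gcd[m,n]≡gcd[cm,cn] d i q ⟨
      d * gcd i q         ∎
    isInV-multiple : ∀ i → isInV d (i * d) ≡ coprimeTo q i
    isInV-multiple i = does-⇔ (mk⇔ to from) (InVℕ? d (i * d)) (gcd i q ≟ 1)
      where
      to : gcd (i * d) n ≡ d ⊎ (d ≡ 1 × i * d ≡ 0) → gcd i q ≡ 1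
      to (inj₁ gcd≡d) = *-cancelˡ-≡ (gcd i q) 1 d
        (trans (sym (gcd[id,n]≡d*gcd[i,q] i)) (trans gcd≡d (sym (*-identityʳ d))))
      to (inj₂ (d≡1 , _)) = ⊥-elim (d≢1 d≡1)
      from : gcd i q ≡ 1 → gcd (i * d) n ≡ d ⊎ (d ≡ 1 × i * d ≡ 0)
      from gcd≡1 = inj₁ (trans (gcd[id,n]≡d*gcd[i,q] i) (trans (cong (d *_) gcd≡1) (*-identityʳ d)))

module _ (n : ℕ) .{{_ : NonZero n}} (2≤n : 2 ≤ n) where

  n≢1 : n ≢ 1
  n≢1 n≡1 = <-irrefl (sym n≡1) 2≤n

  InV-irrelevant : ∀ {d x} (p q : InV n d x) → p ≡ q
  InV-irrelevant (inj₁ p) (inj₁ q) = cong inj₁ (≡-irrelevant p q)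
  InV-irrelevant (inj₂ (p , p′)) (inj₂ (q , q′)) =
    cong₂ (λ u v → inj₂ (u , v)) (≡-irrelevant p q) (≡-irrelevant p′ q′)
  InV-irrelevant (inj₁ gcd≡d) (inj₂ (d≡1 , x≡0)) =
    ⊥-elim (n≢1 (trans (sym (toℕ≡0⇒gcd≡n n x≡0)) (trans gcd≡d d≡1)))
  InV-irrelevant (inj₂ (d≡1 , x≡0)) (inj₁ gcd≡d) =
    ⊥-elim (n≢1 (trans (sym (toℕ≡0⇒gcd≡n n x≡0)) (trans gcd≡d d≡1)))

  -- 0 has gcd n, which is not a vertex of H; it is placed in V₁ instead
  classOf : (x : Fin n) → Σ (Divisor n) (λ d → InV n (val d) x)
  classOf x with toℕ x ≟ 0
  ... | yes x≡0 = div 1 (1∣ n) 2≤n , inj₂ (refl , x≡0)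
  ... | no x≢0  = div (gcd (toℕ x) n) (gcd[m,n]∣n (toℕ x) n) gcd<n , inj₁ refl
    where
    gcd<n : gcd (toℕ x) n < n
    gcd<n = ≤-<-trans (∣⇒≤ {{≢-nonZero x≢0}} (gcd[m,n]∣m (toℕ x) n)) (toℕ<n x)

  embed-injective : ∀ {u v} → embed n u ≡ embed n v → u ≡ v
  embed-injective {d , x , x∈Vd} {e , .x , x∈Ve} refl
    with refl ← val-injective n {d} {e} (InV-unique n (val<n n d) (val<n n e) x∈Vd x∈Ve)
    = cong (λ x∈V → d , x , x∈V) (InV-irrelevant x∈Vd x∈Ve)

  embed-bijective : Bijective _≡_ _≡_ (embed n)
  embed-bijective = embed-injective ,
    λ x → (proj₁ (classOf x) , x , proj₂ (classOf x)) , λ { refl → refl }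

  Adj-gcomp⇔Adj : ∀ u v → Adj (gcomp (DivGraph n) (Gd n)) u v ⇔ Adj (PowerGraph n) (embed n u) (embed n v)
  Adj-gcomp⇔Adj (d , x , x∈Vd) (e , y , y∈Ve) = mk⇔ to from
    where
    to : Adj (gcomp (DivGraph n) (Gd n)) (d , x , x∈Vd) (e , y , y∈Ve) → Adj (PowerGraph n) x y
    to (inj₁ (refl , x~y)) = x~y
    to (inj₂ (d≢e , _ , d∣e⊎e∣d)) = x≢y , Equivalence.from (InV-comparable⇔ n x∈Vd y∈Ve) d∣e⊎e∣d
      where
      x≢y : x ≢ y
      x≢y refl = d≢e (val-injective n (InV-unique n (val<n n d) (val<n n e) x∈Vd y∈Ve))
    from : Adj (PowerGraph n) x y → Adj (gcomp (DivGraph n) (Gd n)) (d , x , x∈Vd) (e , y , y∈Ve)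
    from (x≢y , comparable) with val d ≟ val e
    ... | yes d≡e with refl ← val-injective n {d} {e} d≡e = inj₁ (refl , x≢y , comparable)
    ... | no d≢e =
      inj₂ (d≢e ∘ cong val , d≢e ∘ cong val , Equivalence.to (InV-comparable⇔ n x∈Vd y∈Ve) comparable)

  Gd-complete : ∀ d → IsComplete (Gd n d)
  Gd-complete d (x , x∈V) (y , y∈V) u≢v =
    x≢y , Equivalence.from (InV-comparable⇔ n x∈V y∈V) (inj₁ ∣-refl)
    where
    x≢y : x ≢ y
    x≢y refl = u≢v (cong (x ,_) (InV-irrelevant x∈V y∈V))

  cardV[1]≡φ+1 : cardV n 1 ≡ φ n + 1
  cardV[1]≡φ+1 = begin
    cardV n 1                      ≡⟨ cardV≡countBelow n 1 ⟩
    countBelow (isInV n 1) n       ≡⟨ countBelow-differAt0 n isInV[0] coprime[0]≡false isInV-suc ⟩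
    countBelow (coprimeTo n) n + 1 ≡⟨ cong (_+ 1) (φ≡countBelow-coprimeTo n) ⟨
    φ n + 1                        ∎
    where
    open ≡-Reasoning
    isInV[0] : isInV n 1 0 ≡ true
    isInV[0] = dec-true (InVℕ? n 1 0) (inj₂ (refl , refl))
    coprime[0]≡false : coprimeTo n 0 ≡ false
    coprime[0]≡false = dec-false (gcd 0 n ≟ 1) (n≢1 ∘ trans (sym (gcd-identityˡ n)))
    isInV-suc : ∀ k → isInV n 1 (suc k) ≡ coprimeTo n (suc k)
    isInV-suc k = does-⇔ (mk⇔ (λ { (inj₁ gcd≡1) → gcd≡1 ; (inj₂ (_ , ())) }) inj₁)
                         (InVℕ? n 1 (suc k)) (gcd (suc k) n ≟ 1)

proposition4p5 : (n : ℕ) .{{_ : NonZero n}} → 2 ≤ n →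
    -- G = H[G_d : d ∣ n, d < n] (via the identity on underlying elements)
    (Bijective _≡_ _≡_ (embed n)
      × (∀ u v → Adj (gcomp (DivGraph n) (Gd n)) u v
                   ⇔ Adj (PowerGraph n) (embed n u) (embed n v)))
    -- each G_d is complete
    × (∀ d → IsComplete (Gd n d))
    -- |V_1| = φ(n) + 1
    × cardV n 1 ≡ φ n + 1
    -- |V_d| = φ(n/d) for d > 1
    × (∀ d → 1 < val d → ∀ q → q * val d ≡ n → cardV n (val d) ≡ φ q)
proposition4p5 n 2≤n =
    (embed-bijective n 2≤n , Adj-gcomp⇔Adj n 2≤n)
  , Gd-complete n 2≤n
  , cardV[1]≡φ+1 n 2≤n
  , λ d 1<d → cardV≡φ n (val d) 1<d
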